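{- Let $\widehat{W}$ be the signed plane graph described below and $k$ a positive integer. In every balanced $(2k,k)$-coloring of $\widehat{W}$ in which every facial triangle of $\widehat{W}$ has the triangle property, the vertices $u$ and $v$ have no common color.
   Context: A signed graph is a graph with a signature assigning $+$ or $-$ to each edge; a cycle (triangle) is negative if it has an odd number of negative edges and positive otherwise; a vertex set is balanced if it induces no negative cycle. A balanced $(2k,k)$-coloring assigns to each vertex a set of $k$ colors from $\{1,\dots,2k\}$ so that each color class is balanced. Triangle property: w.r.t. such a coloring, a negative triangle has it if each of the $2k$ colors appears on at least one of its vertices; a positive triangle has it if each color appears on at most two of its vertices. $\widehat{W}$ has vertices $u,v,w,z,t,x_1,\dots,x_5$ and edges $wx_i$ ($1\le i\le5$), $x_1x_2,x_2x_3,x_3x_4,x_4x_5,x_5x_1$, $zx_2,zx_3,zu,zv$, $tx_4,tx_5,tu,tv$, $ux_1,ux_2,ux_5,uv$, $vx_3,vx_4$; the edges $ux_2$ and $vx_4$ are positive and all others negative. It is embedded as a plane triangulation whose $16$ faces are the triangles $wx_1x_2$, $wx_2x_3$, $wx_3x_4$, $wx_4x_5$, $wx_5x_1$, $zx_2x_3$, $tx_4x_5$, $ux_1x_2$, $ux_1x_5$, $ux_2z$, $ux_5t$, $vx_3x_4$, $vx_3z$, $vx_4t$, $uzv$, $utv$. -}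

module Defs where

open import Data.Nat using (ℕ; zero; suc; _≤_; _+_)
open import Data.Nat using (_%_)
open import Data.Fin using (Fin; #_)
open import Data.Fin.Subset using (Subset; _∈_; ∣_∣)
open import Data.List using (List; []; _∷_; length)
open import Data.List.Relation.Unary.All using (All)
open import Data.List.Relation.Unary.Unique.Propositional using (Unique)
open import Data.Maybe using (Maybe; just; nothing)
open import Data.Product using (_×_; _,_; Σ; ∃)
open import Data.Sum using (_⊎_)
open import Relation.Nullary using (¬_; yes; no)
open import Relation.Binary.PropositionalEquality using (_≡_)

Odd : ℕ → Set
Odd n = n % 2 ≡ 1

data Sign : Set where
  pos neg : Sign

V : Set
V = Fin 10

u v w z t x1 x2 x3 x4 x5 : V
u  = # 0
v  = # 1
w  = # 2
z  = # 3
t  = # 4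
x1 = # 5
x2 = # 6
x3 = # 7
x4 = # 8
x5 = # 9

edges : List (V × V × Sign)
edges =
  (w , x1 , neg) ∷ (w , x2 , neg) ∷ (w , x3 , neg) ∷ (w , x4 , neg) ∷ (w , x5 , neg) ∷
  (x1 , x2 , neg) ∷ (x2 , x3 , neg) ∷ (x3 , x4 , neg) ∷ (x4 , x5 , neg) ∷ (x5 , x1 , neg) ∷
  (z , x2 , neg) ∷ (z , x3 , neg) ∷ (z , u , neg) ∷ (z , v , neg) ∷
  (t , x4 , neg) ∷ (t , x5 , neg) ∷ (t , u , neg) ∷ (t , v , neg) ∷
  (u , x1 , neg) ∷ (u , x2 , pos) ∷ (u , x5 , neg) ∷ (u , v , neg) ∷
  (v , x3 , neg) ∷ (v , x4 , pos) ∷ []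

lookupSign : List (V × V × Sign) → V → V → Maybe Sign
lookupSign [] x y = nothing
lookupSign ((a , b , s) ∷ es) x y with a Data.Fin.≟ x | b Data.Fin.≟ y | a Data.Fin.≟ y | b Data.Fin.≟ x
... | yes _ | yes _ | _     | _     = just s
... | _     | _     | yes _ | yes _ = just s
... | _     | _     | _     | _     = lookupSign es x y

σ : V → V → Maybe Sign
σ = lookupSign edges

cyclePairs : List V → List (V × V)
cyclePairs []       = []
cyclePairs (a ∷ as) = go a (a ∷ as)
  where
  go : V → List V → List (V × V)
  go first []           = []
  go first (b ∷ [])     = (b , first) ∷ []
  go first (b ∷ c ∷ cs) = (b , c) ∷ go first (c ∷ cs)

negCount : List (V × V) → ℕ
negCount [] = 0
negCount ((a , b) ∷ ps) with σ a b
... | just neg = suc (negCount ps)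
... | _        = negCount ps

IsEdge : V × V → Set
IsEdge (a , b) = ∃ λ s → σ a b ≡ just s

IsCycle : List V → Set
IsCycle cs = (3 ≤ length cs) × Unique cs × All IsEdge (cyclePairs cs)

IsNegativeCycle : List V → Set
IsNegativeCycle cs = IsCycle cs × Odd (negCount (cyclePairs cs))

Balanced : (V → Set) → Set
Balanced S = ∀ cs → IsNegativeCycle cs → ¬ All S cs

-- colors {1,…,2k} are represented by Fin (k + k)
Coloring : ℕ → Set
Coloring k = V → Subset (k + k)

IsBalancedColoring : (k : ℕ) → Coloring k → Set
IsBalancedColoring k c =
  (∀ x → ∣ c x ∣ ≡ k) × (∀ (i : Fin (k + k)) → Balanced (λ x → i ∈ c x))

faces : List (V × V × V)
faces =
  (w , x1 , x2) ∷ (w , x2 , x3) ∷ (w , x3 , x4) ∷ (w , x4 , x5) ∷ (w , x5 , x1) ∷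
  (z , x2 , x3) ∷ (t , x4 , x5) ∷ (u , x1 , x2) ∷ (u , x1 , x5) ∷ (u , x2 , z) ∷
  (u , x5 , t) ∷ (v , x3 , x4) ∷ (v , x3 , z) ∷ (v , x4 , t) ∷ (u , z , v) ∷
  (u , t , v) ∷ []

NegativeTriangle : V × V × V → Set
NegativeTriangle (a , b , d) = Odd (negCount ((a , b) ∷ (b , d) ∷ (d , a) ∷ []))

TriangleProperty : (k : ℕ) → Coloring k → V × V × V → Set
TriangleProperty k c (a , b , d) =
  (NegativeTriangle (a , b , d) →
     ∀ (i : Fin (k + k)) → i ∈ c a ⊎ i ∈ c b ⊎ i ∈ c d)
  × (¬ NegativeTriangle (a , b , d) →
     ∀ (i : Fin (k + k)) → ¬ (i ∈ c a × i ∈ c b × i ∈ c d))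

{-# OPTIONS --safe #-}
module Submission where

-- Let S be the class of a colour shared by u and v. The negative triangles uzv and utv keep z and
-- t out of S, so the negative faces zx₂x₃ and tx₄x₅ put x₂ or x₃, and x₄ or x₅, into S; not both,
-- since ux₂x₃v and ux₅x₄v are negative 4-cycles. Whatever the choice, w ∈ S would close a negative
-- cycle through u and w (the positive face vx₃x₄ excludes x₃, x₄ together). With w ∉ S the negative
-- faces at w make S ∩ rim a vertex cover of the 5-cycle x₁…x₅, while the positive faces ux₁x₂,
-- vx₃x₄ and the negative cycles ux₁x₅, ux₂x₃v, ux₅x₄v make it independent: impossible on an odd cycle.

open import Defs
open import Data.Nat using (ℕ; _≤_; _+_; _≤?_; _%_)
import Data.Nat as ℕ
open import Data.Fin using (Fin; _≟_)
open import Data.Fin.Subset using (_∈_; _∉_)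
open import Data.Product using (_×_; _,_; proj₁; proj₂)
open import Data.Product.Properties using (≡-dec)
open import Data.Sum using (_⊎_; inj₁; inj₂)
open import Data.Empty using (⊥; ⊥-elim)
open import Data.List using ([]; _∷_; length)
open import Data.List.Relation.Unary.All as All using (All; []; _∷_; all?)
open import Data.Maybe using (just; nothing)
open import Relation.Nullary using (¬_; Dec; yes; no)
open import Relation.Nullary.Decidable using (True; toWitness; _×-dec_)
open import Relation.Binary.Definitions using (DecidableEquality)
open import Relation.Binary.PropositionalEquality using (refl)

_≟ᵥ_ : DecidableEquality V
_≟ᵥ_ = _≟_

open import Data.List.Relation.Unary.Unique.DecPropositional _≟ᵥ_ using (unique?)
open import Data.List.Membership.DecPropositional (≡-dec _≟ᵥ_ (≡-dec _≟ᵥ_ _≟ᵥ_)) using () renaming (_∈?_ to _∈ₗ?_)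

isEdge? : ∀ e → Dec (IsEdge e)
isEdge? (a , b) with σ a b
... | just s  = yes (s , refl)
... | nothing = no λ ()

isNegativeCycle? : ∀ cs → Dec (IsNegativeCycle cs)
isNegativeCycle? cs =
  (3 ≤? length cs ×-dec unique? cs ×-dec all? isEdge? (cyclePairs cs))
  ×-dec negCount (cyclePairs cs) % 2 ℕ.≟ 1

notAllIn-negativeCycle : ∀ {S} → Balanced S →
                         ∀ cs {_ : True (isNegativeCycle? cs)} → ¬ All S cs
notAllIn-negativeCycle balanced cs {isNegative} = balanced cs (toWitness isNegative)

infixr 2 _⊻_

_⊻_ : Set → Set → Set
P ⊻ Q = (P ⊎ Q) × ¬ (P × Q)

⊻-trans : {P Q R : Set} → P ⊻ Q → Q ⊻ R → P → R
⊻-trans (_ , ¬p×q) (inj₁ q , _) p = ⊥-elim (¬p×q (p , q))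
⊻-trans _          (inj₂ r , _) _ = r

⊻-pentagon : {P₁ P₂ P₃ P₄ P₅ : Set} →
             P₁ ⊻ P₂ → P₂ ⊻ P₃ → P₃ ⊻ P₄ → P₄ ⊻ P₅ → P₅ ⊻ P₁ → ⊥
⊻-pentagon p₁₂ p₂₃ p₃₄ p₄₅ p₅₁ with proj₁ p₁₂
... | inj₁ p₁ = proj₂ p₅₁ (⊻-trans p₃₄ p₄₅ (⊻-trans p₁₂ p₂₃ p₁) , p₁)
... | inj₂ p₂ = proj₂ p₁₂ (⊻-trans p₄₅ p₅₁ (⊻-trans p₂₃ p₃₄ p₂) , p₂)

module SharedColour {k} (c : Coloring k) (triangle : All (TriangleProperty k c) faces)
                    (i : Fin (k + k)) (balanced : Balanced (λ x → i ∈ c x))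
                    (i∈u : i ∈ c u) (i∈v : i ∈ c v) where

  onFace : ∀ f {_ : True (f ∈ₗ? faces)} → TriangleProperty k c f
  onFace f {f∈faces} = All.lookup triangle (toWitness f∈faces)

  coveredBeside : ∀ a b d {_ : True ((a , b , d) ∈ₗ? faces)} → NegativeTriangle (a , b , d) →
                  i ∉ c a → i ∈ c b ⊎ i ∈ c d
  coveredBeside a b d {f∈faces} negative i∉a with proj₁ (onFace (a , b , d) {f∈faces}) negative i
  ... | inj₁ i∈a   = ⊥-elim (i∉a i∈a)
  ... | inj₂ i∈b⊎d = i∈b⊎d

  notOnPositiveFace : ∀ a b d {_ : True ((a , b , d) ∈ₗ? faces)} → ¬ NegativeTriangle (a , b , d) →
                      ¬ (i ∈ c a × i ∈ c b × i ∈ c d)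
  notOnPositiveFace a b d {f∈faces} positive = proj₂ (onFace (a , b , d) {f∈faces}) positive i

  notAllIn : ∀ cs {_ : True (isNegativeCycle? cs)} → ¬ All (λ x → i ∈ c x) cs
  notAllIn = notAllIn-negativeCycle balanced

  i∉z : i ∉ c z
  i∉z i∈z = notAllIn (u ∷ z ∷ v ∷ []) (i∈u ∷ i∈z ∷ i∈v ∷ [])

  i∉t : i ∉ c t
  i∉t i∈t = notAllIn (u ∷ t ∷ v ∷ []) (i∈u ∷ i∈t ∷ i∈v ∷ [])

  x₂⊻x₃ : i ∈ c x2 ⊻ i ∈ c x3
  x₂⊻x₃ = coveredBeside z x2 x3 refl i∉z
        , λ (i∈x2 , i∈x3) → notAllIn (u ∷ x2 ∷ x3 ∷ v ∷ []) (i∈u ∷ i∈x2 ∷ i∈x3 ∷ i∈v ∷ [])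

  x₄⊻x₅ : i ∈ c x4 ⊻ i ∈ c x5
  x₄⊻x₅ = coveredBeside t x4 x5 refl i∉t
        , λ (i∈x4 , i∈x5) → notAllIn (u ∷ x5 ∷ x4 ∷ v ∷ []) (i∈u ∷ i∈x5 ∷ i∈x4 ∷ i∈v ∷ [])

  ¬x₃×x₄ : ¬ (i ∈ c x3 × i ∈ c x4)
  ¬x₃×x₄ (i∈x3 , i∈x4) = notOnPositiveFace v x3 x4 (λ ()) (i∈v , i∈x3 , i∈x4)

  i∉w : i ∉ c w
  i∉w i∈w with proj₁ x₂⊻x₃ | proj₁ x₄⊻x₅
  ... | inj₁ i∈x2 | inj₁ i∈x4 = notAllIn (u ∷ x2 ∷ w ∷ x4 ∷ v ∷ []) (i∈u ∷ i∈x2 ∷ i∈w ∷ i∈x4 ∷ i∈v ∷ [])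
  ... | inj₁ i∈x2 | inj₂ i∈x5 = notAllIn (u ∷ x2 ∷ w ∷ x5 ∷ []) (i∈u ∷ i∈x2 ∷ i∈w ∷ i∈x5 ∷ [])
  ... | inj₂ i∈x3 | inj₁ i∈x4 = ¬x₃×x₄ (i∈x3 , i∈x4)
  ... | inj₂ i∈x3 | inj₂ i∈x5 = notAllIn (u ∷ x5 ∷ w ∷ x3 ∷ v ∷ []) (i∈u ∷ i∈x5 ∷ i∈w ∷ i∈x3 ∷ i∈v ∷ [])

  x₁⊻x₂ : i ∈ c x1 ⊻ i ∈ c x2
  x₁⊻x₂ = coveredBeside w x1 x2 refl i∉w
        , λ (i∈x1 , i∈x2) → notOnPositiveFace u x1 x2 (λ ()) (i∈u , i∈x1 , i∈x2)

  x₃⊻x₄ : i ∈ c x3 ⊻ i ∈ c x4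
  x₃⊻x₄ = coveredBeside w x3 x4 refl i∉w , ¬x₃×x₄

  x₅⊻x₁ : i ∈ c x5 ⊻ i ∈ c x1
  x₅⊻x₁ = coveredBeside w x5 x1 refl i∉w
        , λ (i∈x5 , i∈x1) → notAllIn (u ∷ x1 ∷ x5 ∷ []) (i∈u ∷ i∈x1 ∷ i∈x5 ∷ [])

  impossible : ⊥
  impossible = ⊻-pentagon x₁⊻x₂ x₂⊻x₃ x₃⊻x₄ x₄⊻x₅ x₅⊻x₁

lemma2 : (k : ℕ) → 1 ≤ k → (c : Coloring k) → IsBalancedColoring k c →
    All (TriangleProperty k c) faces →
    ∀ (i : Fin (k + k)) → ¬ (i ∈ c u × i ∈ c v)
lemma2 k _ c (_ , balanced) triangle i (i∈u , i∈v) =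
  SharedColour.impossible {k} c triangle i (balanced i) i∈u i∈v
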